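{- For every integer $r \geq 4$, let $O_r = K_{2r} - rK_2$ be the octahedron graph (the complete graph on $2r$ vertices with the edges of a perfect matching removed). Then $sabt(O_r) = r$.
   Context: A star forest is a graph each of whose connected components is a star $K_{1,m}$ ($m \ge 1$). A (strict) book embedding of a graph $G$ consists of a cyclic ordering of its vertices around a circle together with a partition of its edge set into parts (pages) such that no two edges in the same page cross when drawn as chords of the circle. $sabt(G)$ (star arboricity book thickness) is the least number of pages in a strict book embedding of $G$ in which the subgraph formed by the edges of each page is a star forest. -}

module Defs where

open import Level using (0ℓ)
open import Data.Nat using (ℕ; _≤_; _<_; _*_; _/_)
open import Data.Fin using (Fin; toℕ)
open import Data.Product using (Σ; ∃; _×_; _,_)
open import Data.Sum using (_⊎_)
open import Relation.Nullary using (¬_)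
open import Relation.Binary.PropositionalEquality using (_≡_; _≢_)
open import Function.Definitions using (Injective)

record Graph : Set₁ where
  field
    n     : ℕ
    Adj   : Fin n → Fin n → Set
    sym   : ∀ {u v} → Adj u v → Adj v u
    irrefl : ∀ {u} → ¬ Adj u u
open Graph public

-- Octahedron graph O_r = K_{2r} - r K_2 on Fin (2r); the removed perfect
-- matching pairs 2i with 2i+1 (i.e. vertices with the same  toℕ _ / 2 ).
OctAdj : (r : ℕ) → Fin (2 * r) → Fin (2 * r) → Set
OctAdj r i j = (i ≢ j) × (toℕ i / 2 ≢ toℕ j / 2)

octahedron : ℕ → Graph
octahedron r = record
  { n = 2 * r
  ; Adj = OctAdj r
  ; sym = λ { (p , q) → (λ e → p (Relation.Binary.PropositionalEquality.sym e))
                      , (λ e → q (Relation.Binary.PropositionalEquality.sym e)) }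
  ; irrefl = λ { (p , _) → p Relation.Binary.PropositionalEquality.refl }
  }

data Reach {m : ℕ} (H : Fin m → Fin m → Set) : Fin m → Fin m → Set where
  here  : ∀ {x} → Reach H x x
  there : ∀ {x y z} → H x y → Reach H y z → Reach H x z

-- The graph formed by the edge set H (a symmetric relation) is a star forest:
-- every connected component (of a vertex v incident to some edge) is a star,
-- i.e. has a vertex c (its centre) such that every edge of the component
-- contains c.
StarForest : {m : ℕ} → (Fin m → Fin m → Set) → Set
StarForest {m} H =
  ∀ v w → H v w →
    Σ (Fin m) λ c → Reach H v c ×
      (∀ x y → H x y → Reach H v x → (x ≡ c) ⊎ (y ≡ c))

-- Book embedding: the circle ordering is given by the injective map
-- pos : vertices → positions 0..n-1 (read cyclically); chords {a,b} and
-- {c,d} cross iff exactly one of c,d lies strictly between a and b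
-- (and the other is not an endpoint of {a,b}).
module _ {m : ℕ} (pos : Fin m → Fin m) where
  Between : Fin m → Fin m → Fin m → Set
  Between x a b = (toℕ (pos a) < toℕ (pos x) × toℕ (pos x) < toℕ (pos b))
                ⊎ (toℕ (pos b) < toℕ (pos x) × toℕ (pos x) < toℕ (pos a))

  Cross : Fin m → Fin m → Fin m → Fin m → Set
  Cross a b c d =
      (Between c a b × ¬ Between d a b × d ≢ a × d ≢ b)
    ⊎ (Between d a b × ¬ Between c a b × c ≢ a × c ≢ b)

record StarBookEmbedding (G : Graph) (k : ℕ) : Set where
  field
    pos      : Fin (n G) → Fin (n G)
    pos-inj  : Injective _≡_ _≡_ pos
    page     : Fin (n G) → Fin (n G) → Fin k
    page-sym : ∀ u v → Adj G u v → page u v ≡ page v u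
    noCross  : ∀ a b c d → Adj G a b → Adj G c d →
               page a b ≡ page c d → ¬ Cross pos a b c d
    stars    : ∀ (p : Fin k) →
               StarForest (λ x y → Adj G x y × page x y ≡ p)

SabtIs : Graph → ℕ → Set
SabtIs G k = StarBookEmbedding G k × (∀ j → StarBookEmbedding G j → k ≤ j)

{-# OPTIONS --safe #-}
-- Upper bound: put the two ends of every removed matching edge at antipodal
-- points of a circle of 2r points.  An edge is owned by the endpoint from
-- which the other one lies less than half a turn ahead, and goes to the page
-- given by its owner mod r.  Page i is then the star at point i together with
-- the star at point i + r; their leaves lie on opposite half-circles, so the
-- page is a non-crossing star forest.
--
-- Lower bound: orient every edge of a star forest towards the centre of its
-- star.  Out-degrees are at most 1 and every component has a sink; since no
-- vertex of O_r is adjacent to all others, a page has at least two components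
-- and so at most 2r - 2 edges, while O_r has 2r(r - 1) edges.
module Submission where

open import Defs hiding (n; sym; irrefl)
open import Algebra.Properties.CommutativeMonoid.Sum as ∑ using ()
open import Data.Nat using (ℕ; zero; suc; _+_; _*_; _∸_; _<_; _≤_; _/_; _%_; z≤n; s≤s; NonZero; >-nonZero⁻¹; _≤?_; _<?_; _≟_)
open import Data.Nat.Properties
open import Data.Nat.DivMod using (_mod_; m≡m%n+[m/n]*n; m%n<n; m<n⇒m%n≡m; [m+kn]%n≡m%n; m<n*o⇒m/o<n)
open import Data.Fin as Fin using (Fin; toℕ)
import Data.Fin.Properties as Finₚ
open import Data.Product using (∃; ∃-syntax; _×_; _,_; proj₁; proj₂)
open import Data.Sum using (_⊎_; inj₁; inj₂; swap; [_,_])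
open import Data.Empty using (⊥-elim)
open import Relation.Nullary using (¬_; Dec; yes; no; contradiction)
open import Relation.Nullary.Decidable using (_×-dec_; _⊎-dec_; ¬?)
open import Relation.Binary.Definitions using (tri<; tri≈; tri>)
open import Function using (_∘_)
open import Relation.Unary using (Pred; Decidable)
open import Relation.Binary.PropositionalEquality using (_≡_; _≢_; refl; sym; trans; cong; cong₂; subst; subst₂; module ≡-Reasoning)
open import Data.Nat.Solver using (module +-*-Solver)
open +-*-Solver using (solve; _:+_; _:*_; con; _:=_)

open ∑ +-0-commutativeMonoid using (sum; sum-syntax; ∑-distrib-+; ∑-comm; sum-cong-≗)

∑-const : ∀ n c → ∑[ i < n ] c ≡ n * c
∑-const zero    c = refl
∑-const (suc n) c = cong (c +_) (∑-const n c)

∑-mono-≤ : ∀ {n} {f g : Fin n → ℕ} → (∀ i → f i ≤ g i) → sum f ≤ sum g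
∑-mono-≤ {zero}  f≤g = z≤n
∑-mono-≤ {suc n} f≤g = +-mono-≤ (f≤g Fin.zero) (∑-mono-≤ (λ i → f≤g (Fin.suc i)))

term≤∑ : ∀ {n} (f : Fin n → ℕ) i → f i ≤ sum f
term≤∑ f Fin.zero    = m≤m+n _ _
term≤∑ f (Fin.suc i) = ≤-trans (term≤∑ (λ k → f (Fin.suc k)) i) (m≤n+m _ _)

iverson : ∀ {A : Set} → Dec A → ℕ
iverson (yes _) = 1
iverson (no _)  = 0

iverson-yes : ∀ {A : Set} (d : Dec A) → A → iverson d ≡ 1
iverson-yes (yes _) _ = refl
iverson-yes (no ¬a) a = contradiction a ¬a

iverson-no : ∀ {A : Set} (d : Dec A) → ¬ A → iverson d ≡ 0
iverson-no (yes a) ¬a = contradiction a ¬a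
iverson-no (no _)  _  = refl

iverson-⊎ : ∀ {A B C : Set} → (A → B ⊎ C) → (a : Dec A) (b : Dec B) (c : Dec C) →
            iverson a ≤ iverson b + iverson c
iverson-⊎ _   (no _)  _       _       = z≤n
iverson-⊎ _   (yes _) (yes _) _       = s≤s z≤n
iverson-⊎ _   (yes _) (no _)  (yes _) = s≤s z≤n
iverson-⊎ A⇒B⊎C (yes a) (no ¬b) (no ¬c) with A⇒B⊎C a
... | inj₁ b = contradiction b ¬b
... | inj₂ c = contradiction c ¬c

∑-iverson≡0 : ∀ {n} {P : Pred (Fin n) _} (P? : Decidable P) → (∀ i → ¬ P i) → ∑[ i < n ] iverson (P? i) ≡ 0
∑-iverson≡0 {n} P? ¬P = trans (sum-cong-≗ (λ i → iverson-no (P? i) (¬P i))) (trans (∑-const n 0) (*-zeroʳ n))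

∑-iverson-≤1 : ∀ {n} {P : Pred (Fin n) _} (P? : Decidable P) → (∀ {i k} → P i → P k → i ≡ k) →
               ∑[ i < n ] iverson (P? i) ≤ 1
∑-iverson-≤1 {zero}  P? unique = z≤n
∑-iverson-≤1 {suc n} {P} P? unique = split (P? Fin.zero)
  where
    split : (d : Dec (P Fin.zero)) → iverson d + ∑[ i < n ] iverson (P? (Fin.suc i)) ≤ 1
    split (yes P0) = ≤-reflexive (cong suc (∑-iverson≡0 (λ i → P? (Fin.suc i)) (λ i Pi → 0≢1+n (cong toℕ (unique P0 Pi)))))
    split (no _)   = ∑-iverson-≤1 (λ i → P? (Fin.suc i)) (λ Pi Pk → Finₚ.suc-injective (unique Pi Pk))

∑-iverson≡0⊎∃ : ∀ {n} {P : Pred (Fin n) _} (P? : Decidable P) → ∑[ i < n ] iverson (P? i) ≡ 0 ⊎ ∃ P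
∑-iverson≡0⊎∃ P? with Finₚ.any? P?
... | yes witness = inj₂ witness
... | no ∄P       = inj₁ (∑-iverson≡0 P? (λ i Pi → ∄P (i , Pi)))

δ : ∀ {n} → Fin n → Fin n → ℕ
δ z i = iverson (i Fin.≟ z)

∑-δ≡1 : ∀ {n} (z : Fin n) → ∑[ i < n ] δ z i ≡ 1
∑-δ≡1 z = ≤-antisym (∑-iverson-≤1 (Fin._≟ z) (λ i≡z k≡z → trans i≡z (sym k≡z)))
                    (≤-trans (≤-reflexive (sym (iverson-yes (z Fin.≟ z) refl))) (term≤∑ (δ z) z))

two-zeros⇒∑+2≤n : ∀ {n} (f : Fin n → ℕ) → (∀ i → f i ≤ 1) →
                  ∀ {z₁ z₂} → z₁ ≢ z₂ → f z₁ ≡ 0 → f z₂ ≡ 0 → sum f + 2 ≤ n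
two-zeros⇒∑+2≤n {n} f f≤1 {z₁} {z₂} z₁≢z₂ fz₁≡0 fz₂≡0 = begin
  sum f + 2                              ≡⟨ cong (sum f +_) (cong₂ _+_ (∑-δ≡1 z₁) (∑-δ≡1 z₂)) ⟨
  sum f + (sum (δ z₁) + sum (δ z₂))      ≡⟨ cong (sum f +_) (∑-distrib-+ (δ z₁) (δ z₂)) ⟨
  sum f + ∑[ i < n ] (δ z₁ i + δ z₂ i)   ≡⟨ ∑-distrib-+ f (λ i → δ z₁ i + δ z₂ i) ⟨
  ∑[ i < n ] (f i + (δ z₁ i + δ z₂ i))   ≤⟨ ∑-mono-≤ pointwise ⟩
  ∑[ i < n ] 1                           ≡⟨ trans (∑-const n 1) (*-identityʳ n) ⟩
  n                                      ∎
  where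
    open ≤-Reasoning
    pointwise : ∀ i → f i + (δ z₁ i + δ z₂ i) ≤ 1
    pointwise i with i Fin.≟ z₁ | i Fin.≟ z₂
    ... | yes refl | yes refl = contradiction refl z₁≢z₂
    ... | yes refl | no _     = ≤-reflexive (cong (_+ 1) fz₁≡0)
    ... | no _     | yes refl = ≤-reflexive (cong (_+ 1) fz₂≡0)
    ... | no _     | no _     = ≤-trans (≤-reflexive (+-identityʳ (f i))) (f≤1 i)

quotient-remainder-unique : ∀ {n a b h k} .{{_ : NonZero n}} → a < n → b < n →
                            a + h * n ≡ b + k * n → a ≡ b × h ≡ k
quotient-remainder-unique {n} {a} {b} {h} {k} a<n b<n eq = a≡b , h≡k
  where
    a≡b : a ≡ b
    a≡b = begin
      a               ≡⟨ m<n⇒m%n≡m a<n ⟨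
      a % n           ≡⟨ [m+kn]%n≡m%n a h n ⟨
      (a + h * n) % n ≡⟨ cong (_% n) eq ⟩
      (b + k * n) % n ≡⟨ [m+kn]%n≡m%n b k n ⟩
      b % n           ≡⟨ m<n⇒m%n≡m b<n ⟩
      b               ∎
      where open ≡-Reasoning
    h≡k : h ≡ k
    h≡k = *-cancelʳ-≡ h k n (+-cancelˡ-≡ a (h * n) (k * n) (trans eq (cong (_+ k * n) (sym a≡b))))

1∸n≢n : ∀ n → 1 ∸ n ≢ n
1∸n≢n zero          ()
1∸n≢n (suc zero)    ()
1∸n≢n (suc (suc n)) ()

<2⇒≡⊎≡1∸ : ∀ {a b} → a < 2 → b < 2 → a ≡ b ⊎ a ≡ 1 ∸ b
<2⇒≡⊎≡1∸ {0} {0} _ _ = inj₁ refl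
<2⇒≡⊎≡1∸ {0} {1} _ _ = inj₂ refl
<2⇒≡⊎≡1∸ {1} {0} _ _ = inj₂ refl
<2⇒≡⊎≡1∸ {1} {1} _ _ = inj₁ refl
<2⇒≡⊎≡1∸ {suc (suc _)} (s≤s (s≤s ())) _
<2⇒≡⊎≡1∸ {_} {suc (suc _)} _ (s≤s (s≤s ()))

centres⇒starForest : ∀ {m} {H : Fin m → Fin m → Set} (C : Fin m → Set) →
                     (∀ {x y} → H x y → H y x) →
                     (∀ {x y} → H x y → C x ⊎ C y) →
                     (∀ {x y} → H x y → C x → ¬ C y) →
                     (∀ {x c c′} → H x c → H x c′ → C c → C c′ → c ≡ c′) →
                     StarForest H
centres⇒starForest {m} {H} C H-sym centre-end centres-nonadjacent one-centre v w vw =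
  [ (λ Cv → v , here , covers Cv (inj₁ refl)) , (λ Cw → w , there vw here , covers Cw (inj₂ vw)) ] (centre-end vw)
  where
    covers : ∀ {c} → C c → v ≡ c ⊎ H v c → ∀ x y → H x y → Reach H v x → x ≡ c ⊎ y ≡ c
    covers {c} Cc v-near x y xy v⇝x = proj₂ (step (near-reachable v⇝x v-near) xy)
      where
        Near : Fin m → Set
        Near z = z ≡ c ⊎ H z c

        step : ∀ {z z′} → Near z → H z z′ → Near z′ × (z ≡ c ⊎ z′ ≡ c)
        step (inj₁ refl)          zz′ = inj₂ (H-sym zz′) , inj₁ refl
        step {z′ = z′} (inj₂ zc) zz′ = inj₁ z′≡c , inj₂ z′≡c
          where
            Cz′ : C z′
            Cz′ = [ (λ Cz → ⊥-elim (centres-nonadjacent zc Cz Cc)) , (λ Cz′ → Cz′) ] (centre-end zz′)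
            z′≡c : z′ ≡ c
            z′≡c = sym (one-centre zc zz′ Cc Cz′)

        near-reachable : ∀ {z x} → Reach H z x → Near z → Near x
        near-reachable here             near = near
        near-reachable (there zz′ z′⇝x) near = near-reachable z′⇝x (proj₁ (step near zz′))

module StarForestOrientation
  {m} {H : Fin m → Fin m → Set} (H? : ∀ x y → Dec (H x y))
  (H-sym : ∀ {x y} → H x y → H y x) (H-irrefl : ∀ {x} → ¬ H x x) (star : StarForest H)
  where

  Covers : Fin m → Fin m → Set
  Covers x c = ∀ x′ y′ → H x′ y′ → Reach H x x′ → x′ ≡ c ⊎ y′ ≡ c

  private
    centreFrom : Fin m → Fin m → Fin m
    centreFrom x y with H? x y
    ... | yes h = proj₁ (star x y h)
    ... | no _  = x

    centreFrom-spec : ∀ {x y} → H x y → (centreFrom x y ≡ x ⊎ centreFrom x y ≡ y) × Covers x (centreFrom x y)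
    centreFrom-spec {x} {y} h with H? x y
    ... | no ¬h = contradiction h ¬h
    ... | yes h′ with star x y h′
    ...   | c , _ , covers with covers x y h′ here
    ...     | inj₁ x≡c = inj₁ (sym x≡c) , covers
    ...     | inj₂ y≡c = inj₂ (sym y≡c) , covers

  -- Breaking ties by vertex order makes the choice symmetric, so that
  -- a component K₂ gets exactly one centre.
  centre : Fin m → Fin m → Fin m
  centre x y with toℕ x ≤? toℕ y
  ... | yes _ = centreFrom x y
  ... | no _  = centreFrom y x

  centre-spec : ∀ {x y} → H x y → (centre x y ≡ x ⊎ centre x y ≡ y) × Covers x (centre x y)
  centre-spec {x} {y} h with toℕ x ≤? toℕ y
  ... | yes _ = centreFrom-spec h
  ... | no _ with centreFrom-spec (H-sym h)
  ...   | c∈yx , covers = swap c∈yx , λ x′ y′ h′ reach → covers x′ y′ h′ (there (H-sym h) reach)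

  centre-sym : ∀ {x y} → H x y → centre x y ≡ centre y x
  centre-sym {x} {y} h with toℕ x ≤? toℕ y | toℕ y ≤? toℕ x
  ... | yes x≤y | yes y≤x = contradiction (subst (H x) (sym (Finₚ.toℕ-injective (≤-antisym x≤y y≤x))) h) H-irrefl
  ... | yes _   | no _    = refl
  ... | no _    | yes _   = refl
  ... | no x≰y  | no y≰x  = contradiction (<⇒≤ (≰⇒> y≰x)) x≰y

  Toward : Fin m → Fin m → Set
  Toward x y = H x y × centre x y ≡ y

  Toward? : ∀ x y → Dec (Toward x y)
  Toward? x y = H? x y ×-dec (centre x y Fin.≟ y)

  toward-total : ∀ {x y} → H x y → Toward x y ⊎ Toward y x
  toward-total {x} {y} h with proj₁ (centre-spec h)
  ... | inj₁ c≡x = inj₂ (H-sym h , trans (sym (centre-sym h)) c≡x)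
  ... | inj₂ c≡y = inj₁ (h , c≡y)

  toward-functional : ∀ {x y y′} → Toward x y → Toward x y′ → y ≡ y′
  toward-functional {x} {y} {y′} (h , c≡y) (h′ , _) with proj₂ (centre-spec h) x y′ h′ here
  ... | inj₁ x≡c = contradiction (subst (H x) (sym (trans x≡c c≡y)) h) H-irrefl
  ... | inj₂ y′≡c = sym (trans y′≡c c≡y)

  toward-sink : ∀ {x z w} → Toward x z → ¬ Toward z w
  toward-sink {x} {z} {w} (h , cxz≡z) (h′ , czw≡w) with proj₂ (centre-spec h′) z x (H-sym h) here
  ... | inj₁ z≡c = contradiction (subst (H z) (sym (trans z≡c czw≡w)) h′) H-irrefl
  ... | inj₂ x≡c = contradiction (subst (H x) (trans (sym cxz≡z) (trans (centre-sym h) czx≡x)) h) H-irrefl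
    where
      czx≡x : centre z x ≡ x
      czx≡x = subst (λ t → centre z t ≡ t) (sym (trans x≡c czw≡w)) czw≡w

  outdegree : Fin m → ℕ
  outdegree x = ∑[ y < m ] iverson (Toward? x y)

  outdegree≤1 : ∀ x → outdegree x ≤ 1
  outdegree≤1 x = ∑-iverson-≤1 (Toward? x) toward-functional

  toward⇒outdegree≡0 : ∀ {x z} → Toward x z → outdegree z ≡ 0
  toward⇒outdegree≡0 t = ∑-iverson≡0 (Toward? _) (λ w → toward-sink t)

  sink-near : ∀ x → ∃[ z ] outdegree z ≡ 0 × (z ≡ x ⊎ H x z)
  sink-near x with ∑-iverson≡0⊎∃ (Toward? x)
  ... | inj₁ out≡0            = x , out≡0 , inj₁ refl
  ... | inj₂ (z , (h , c≡z)) = z , toward⇒outdegree≡0 (h , c≡z) , inj₂ h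

  degree-sum≤twice-outdegree-sum :
    ∑[ x < m ] ∑[ y < m ] iverson (H? x y) ≤ ∑[ x < m ] outdegree x + ∑[ x < m ] outdegree x
  degree-sum≤twice-outdegree-sum = begin
    ∑[ x < m ] ∑[ y < m ] iverson (H? x y)
      ≤⟨ ∑-mono-≤ (λ x → ∑-mono-≤ (λ y → split x y)) ⟩
    ∑[ x < m ] ∑[ y < m ] (t x y + t y x)
      ≡⟨ sum-cong-≗ (λ x → ∑-distrib-+ (t x) (λ y → t y x)) ⟩
    ∑[ x < m ] (outdegree x + ∑[ y < m ] t y x)
      ≡⟨ ∑-distrib-+ outdegree (λ x → ∑[ y < m ] t y x) ⟩
    ∑[ x < m ] outdegree x + ∑[ x < m ] ∑[ y < m ] t y x
      ≡⟨ cong (∑[ x < m ] outdegree x +_) (∑-comm (λ x y → t y x)) ⟩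
    ∑[ x < m ] outdegree x + ∑[ x < m ] outdegree x ∎
    where
      open ≤-Reasoning
      t : Fin m → Fin m → ℕ
      t x y = iverson (Toward? x y)
      split : ∀ x y → iverson (H? x y) ≤ t x y + t y x
      split x y = iverson-⊎ toward-total (H? x y) (Toward? x y) (Toward? y x)

  -- Each edge is counted twice, and without a dominating vertex there are
  -- at least two sinks.
  degree-sum+4≤2m : Fin m → (∀ x → ∃[ y ] y ≢ x × ¬ H x y) →
                    ∑[ x < m ] ∑[ y < m ] iverson (H? x y) + 4 ≤ 2 * m
  degree-sum+4≤2m x₀ undominated with sink-near x₀
  ... | z₁ , out-z₁≡0 , _ with undominated z₁
  ...   | y , y≢z₁ , ¬z₁~y with sink-near y
  ...     | z₂ , out-z₂≡0 , z₂-near-y = begin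
    ∑[ x < m ] ∑[ y < m ] iverson (H? x y) + 4 ≤⟨ +-monoˡ-≤ 4 degree-sum≤twice-outdegree-sum ⟩
    S + S + 4                                  ≡⟨ solve 1 (λ s → s :+ s :+ con 4 := (s :+ con 2) :+ (s :+ con 2)) refl S ⟩
    (S + 2) + (S + 2)                          ≤⟨ +-mono-≤ S+2≤m S+2≤m ⟩
    m + m                                      ≡⟨ cong (m +_) (+-identityʳ m) ⟨
    2 * m                                      ∎
    where
      open ≤-Reasoning
      S : ℕ
      S = ∑[ x < m ] outdegree x
      z₁≢z₂ : z₁ ≢ z₂
      z₁≢z₂ refl = [ (λ z₁≡y → y≢z₁ (sym z₁≡y)) , (λ y~z₁ → ¬z₁~y (H-sym y~z₁)) ] z₂-near-y
      S+2≤m : S + 2 ≤ m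
      S+2≤m = two-zeros⇒∑+2≤n outdegree outdegree≤1 z₁≢z₂ out-z₁≡0 out-z₂≡0

Inside : ℕ → ℕ → ℕ → Set
Inside x a b = (a < x × x < b) ⊎ (b < x × x < a)

inside-≢ : ∀ {x a b} → Inside x a b → x ≢ a × x ≢ b
inside-≢ (inj₁ (a<x , x<b)) = >⇒≢ a<x , <⇒≢ x<b
inside-≢ (inj₂ (b<x , x<a)) = <⇒≢ x<a , >⇒≢ b<x

SameSide : ℕ → ℕ → ℕ → ℕ → Set
SameSide a b c d = (Inside c a b × Inside d a b) ⊎ (¬ Inside c a b × ¬ Inside d a b)

sameSide-swapˡ : ∀ {a b c d} → SameSide a b c d → SameSide b a c d
sameSide-swapˡ (inj₁ (c-in , d-in))   = inj₁ (swap c-in , swap d-in)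
sameSide-swapˡ (inj₂ (c-out , d-out)) = inj₂ (c-out ∘ swap , d-out ∘ swap)

sameSide-swapʳ : ∀ {a b c d} → SameSide a b c d → SameSide a b d c
sameSide-swapʳ (inj₁ (c-in , d-in))   = inj₁ (d-in , c-in)
sameSide-swapʳ (inj₂ (c-out , d-out)) = inj₂ (d-out , c-out)

module _ {m} (pos : Fin m → Fin m) where

  private
    place : Fin m → ℕ
    place v = toℕ (pos v)

  sameSide⇒¬Cross : ∀ {a b c d} → SameSide (place a) (place b) (place c) (place d) → ¬ Cross pos a b c d
  sameSide⇒¬Cross (inj₁ (_ , d-in))   (inj₁ (_ , d-out , _))    = d-out d-in
  sameSide⇒¬Cross (inj₁ (c-in , _))   (inj₂ (_ , c-out , _))    = c-out c-in
  sameSide⇒¬Cross (inj₂ (c-out , _))  (inj₁ (c-in , _))         = c-out c-in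
  sameSide⇒¬Cross (inj₂ (_ , d-out))  (inj₂ (d-in , _))         = d-out d-in

  Cross⇒endpoints≢ : ∀ {a b c d} → Cross pos a b c d → c ≢ a × c ≢ b × d ≢ a × d ≢ b
  Cross⇒endpoints≢ (inj₁ (c-in , _ , d≢a , d≢b)) =
    proj₁ (inside-≢ c-in) ∘ cong place , proj₂ (inside-≢ c-in) ∘ cong place , d≢a , d≢b
  Cross⇒endpoints≢ (inj₂ (d-in , _ , c≢a , c≢b)) =
    c≢a , c≢b , proj₁ (inside-≢ d-in) ∘ cong place , proj₂ (inside-≢ d-in) ∘ cong place

-- Points 0, …, 2r - 1 of a circle, a and a + r being antipodal.
module Circle (r : ℕ) .{{_ : NonZero r}} where

  Chord : ℕ → ℕ → Set
  Chord a b = a ≢ b × b ≢ a + r × a ≢ b + r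

  -- z lies on the open half-circle that follows o.
  Owns : ℕ → ℕ → Set
  Owns o z = (o < z × z < o + r) ⊎ (z + r < o)

  Owns? : ∀ o z → Dec (Owns o z)
  Owns? o z = ((o <? z) ×-dec (z <? o + r)) ⊎-dec (z + r <? o)

  owns-asym : ∀ {x y} → Owns x y → ¬ Owns y x
  owns-asym (inj₁ (x<y , _))    (inj₁ (y<x , _)) = <-asym x<y y<x
  owns-asym (inj₁ (_ , y<x+r))  (inj₂ x+r<y)     = <-asym y<x+r x+r<y
  owns-asym (inj₂ y+r<x)        (inj₁ (_ , x<y+r)) = <-asym x<y+r y+r<x
  owns-asym {x} {y} (inj₂ y+r<x) (inj₂ x+r<y) =
    <-asym (≤-<-trans (m≤m+n y r) y+r<x) (≤-<-trans (m≤m+n x r) x+r<y)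

  chord⇒owns : ∀ {a b} → Chord a b → Owns a b ⊎ Owns b a
  chord⇒owns {a} {b} (a≢b , b≢a+r , a≢b+r) with <-cmp a b
  ... | tri≈ _ a≡b _ = contradiction a≡b a≢b
  ... | tri< a<b _ _ with <-cmp b (a + r)
  ...   | tri< b<a+r _ _ = inj₁ (inj₁ (a<b , b<a+r))
  ...   | tri≈ _ b≡a+r _ = contradiction b≡a+r b≢a+r
  ...   | tri> _ _ a+r<b = inj₂ (inj₂ a+r<b)
  chord⇒owns {a} {b} (a≢b , b≢a+r , a≢b+r) | tri> _ _ b<a with <-cmp a (b + r)
  ...   | tri< a<b+r _ _ = inj₂ (inj₁ (b<a , a<b+r))
  ...   | tri≈ _ a≡b+r _ = contradiction a≡b+r a≢b+r
  ...   | tri> _ _ b+r<a = inj₁ (inj₂ b+r<a)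

  owner : ℕ → ℕ → ℕ
  owner a b with Owns? a b
  ... | yes _ = a
  ... | no _  = b

  owner-spec : ∀ {a b} → Chord a b → (Owns a b × owner a b ≡ a) ⊎ (Owns b a × owner a b ≡ b)
  owner-spec {a} {b} ab with Owns? a b
  ... | yes a-owns = inj₁ (a-owns , refl)
  ... | no ¬a-owns with chord⇒owns ab
  ...   | inj₁ a-owns = contradiction a-owns ¬a-owns
  ...   | inj₂ b-owns = inj₂ (b-owns , refl)

  chord-sym : ∀ {a b} → Chord a b → Chord b a
  chord-sym (a≢b , b≢a+r , a≢b+r) = a≢b ∘ sym , a≢b+r , b≢a+r

  owner-sym : ∀ {a b} → Chord a b → owner a b ≡ owner b a
  owner-sym ab with owner-spec ab | owner-spec (chord-sym ab)
  ... | inj₁ (_ , ≡a)     | inj₂ (_ , ≡a′)    = trans ≡a (sym ≡a′)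
  ... | inj₂ (_ , ≡b)     | inj₁ (_ , ≡b′)    = trans ≡b (sym ≡b′)
  ... | inj₁ (a-owns , _) | inj₁ (b-owns , _) = contradiction b-owns (owns-asym a-owns)
  ... | inj₂ (b-owns , _) | inj₂ (a-owns , _) = contradiction a-owns (owns-asym b-owns)

  <2r⇒≡%⊎≡%+r : ∀ {a} → a < 2 * r → a ≡ a % r ⊎ a ≡ a % r + r
  <2r⇒≡%⊎≡%+r {a} a<2r with a / r | m<n*o⇒m/o<n {a} {2} {r} a<2r | m≡m%n+[m/n]*n a r
  ... | 0 | _ | a≡ = inj₁ (trans a≡ (+-identityʳ (a % r)))
  ... | 1 | _ | a≡ = inj₂ (trans a≡ (cong (a % r +_) (+-identityʳ r)))
  ... | suc (suc _) | s≤s (s≤s ()) | _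

  ≡%⇒≡⊎antipodal : ∀ {a b} → a < 2 * r → b < 2 * r → a % r ≡ b % r → a ≡ b ⊎ b ≡ a + r ⊎ a ≡ b + r
  ≡%⇒≡⊎antipodal a<2r b<2r a%≡b% with <2r⇒≡%⊎≡%+r a<2r | <2r⇒≡%⊎≡%+r b<2r
  ... | inj₁ a≡ | inj₁ b≡ = inj₁ (trans a≡ (trans a%≡b% (sym b≡)))
  ... | inj₁ a≡ | inj₂ b≡ = inj₂ (inj₁ (trans b≡ (cong (_+ r) (trans (sym a%≡b%) (sym a≡)))))
  ... | inj₂ a≡ | inj₁ b≡ = inj₂ (inj₂ (trans a≡ (cong (_+ r) (trans a%≡b% (sym b≡)))))
  ... | inj₂ a≡ | inj₂ b≡ = inj₁ (trans a≡ (trans (cong (_+ r) a%≡b%) (sym b≡)))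

  chord⇒%≢ : ∀ {a b} → a < 2 * r → b < 2 * r → Chord a b → a % r ≢ b % r
  chord⇒%≢ a<2r b<2r (a≢b , b≢a+r , a≢b+r) a%≡b% with ≡%⇒≡⊎antipodal a<2r b<2r a%≡b%
  ... | inj₁ a≡b        = a≢b a≡b
  ... | inj₂ (inj₁ b≡)  = b≢a+r b≡
  ... | inj₂ (inj₂ a≡)  = a≢b+r a≡

  +r<2r⇒<r : ∀ {o} → o + r < 2 * r → o < r
  +r<2r⇒<r {o} o+r<2r = +-cancelʳ-< r o r (subst (o + r <_) (cong (r +_) (+-identityʳ r)) o+r<2r)

  owns-disjoint : ∀ {o z} → o + r < 2 * r → Owns o z → ¬ Owns (o + r) z
  owns-disjoint {o} {z} o+r<2r (inj₂ z+r<o) _ = <⇒≱ (<-trans z+r<o (+r<2r⇒<r o+r<2r)) (m≤n+m r z)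
  owns-disjoint _ (inj₁ (_ , z<o+r)) (inj₁ (o+r<z , _)) = <-asym z<o+r o+r<z
  owns-disjoint {o} {z} _ (inj₁ (o<z , _)) (inj₂ z+r<o+r) = <-asym o<z (+-cancelʳ-< r z o z+r<o+r)

  owned-sameSide-antipodalˡ : ∀ {o l l′} → o + r < 2 * r → Owns o l → Owns (o + r) l′ → SameSide o l (o + r) l′
  owned-sameSide-antipodalˡ {o} {l} o+r<2r (inj₂ l+r<o) _ =
    contradiction (<-trans l+r<o (+r<2r⇒<r o+r<2r)) (≤⇒≯ (m≤n+m r l))
  owned-sameSide-antipodalˡ {o} {l} {l′} _ (inj₁ (o<l , l<o+r)) o+r-owns-l′ = inj₂ (antipode-out , l′-out o+r-owns-l′)
    where
      antipode-out : ¬ Inside (o + r) o l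
      antipode-out (inj₁ (_ , o+r<l)) = <-asym o+r<l l<o+r
      antipode-out (inj₂ (_ , o+r<o)) = ≤⇒≯ (m≤m+n o r) o+r<o
      l′-out : Owns (o + r) l′ → ¬ Inside l′ o l
      l′-out (inj₁ (o+r<l′ , _)) (inj₁ (_ , l′<l)) = <-asym (<-trans l′<l l<o+r) o+r<l′
      l′-out (inj₁ (o+r<l′ , _)) (inj₂ (_ , l′<o)) = ≤⇒≯ (≤-trans (m≤m+n o r) (<⇒≤ o+r<l′)) l′<o
      l′-out (inj₂ l′+r<o+r)     (inj₁ (o<l′ , _)) = <-asym o<l′ (+-cancelʳ-< r l′ o l′+r<o+r)
      l′-out (inj₂ _)            (inj₂ (l<l′ , l′<o)) = <-asym (<-trans o<l l<l′) l′<o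

  owned-sameSide-antipodalʳ : ∀ {o l l′} → o + r < 2 * r → Owns o l′ → Owns (o + r) l → SameSide (o + r) l o l′
  owned-sameSide-antipodalʳ {o} {l} {l′} o+r<2r (inj₂ l′+r<o) _ =
    contradiction (<-trans l′+r<o (+r<2r⇒<r o+r<2r)) (≤⇒≯ (m≤n+m r l′))
  owned-sameSide-antipodalʳ {o} {l} {l′} _ (inj₁ (o<l′ , l′<o+r)) (inj₁ (o+r<l , _)) = inj₂ (o-out , l′-out)
    where
      o-out : ¬ Inside o (o + r) l
      o-out (inj₁ (o+r<o , _)) = ≤⇒≯ (m≤m+n o r) o+r<o
      o-out (inj₂ (l<o , _))   = <-asym l<o (≤-<-trans (m≤m+n o r) o+r<l)
      l′-out : ¬ Inside l′ (o + r) l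
      l′-out (inj₁ (o+r<l′ , _)) = <-asym o+r<l′ l′<o+r
      l′-out (inj₂ (l<l′ , _))   = <-asym l<l′ (<-trans l′<o+r o+r<l)
  owned-sameSide-antipodalʳ {o} {l} {l′} _ (inj₁ (o<l′ , l′<o+r)) (inj₂ l+r<o+r) =
    inj₁ (inj₂ (l<o , m<m+n o (>-nonZero⁻¹ r)) , inj₂ (<-trans l<o o<l′ , l′<o+r))
    where
      l<o : l < o
      l<o = +-cancelʳ-< r l o l+r<o+r

  owned-sameSide : ∀ {o o′ l l′} → o < 2 * r → o′ < 2 * r → o ≢ o′ → o % r ≡ o′ % r →
                   Owns o l → Owns o′ l′ → SameSide o l o′ l′
  owned-sameSide o<2r o′<2r o≢o′ o%≡o′% o-owns o′-owns with ≡%⇒≡⊎antipodal o<2r o′<2r o%≡o′%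
  ... | inj₁ o≡o′        = contradiction o≡o′ o≢o′
  ... | inj₂ (inj₁ refl) = owned-sameSide-antipodalˡ o′<2r o-owns o′-owns
  ... | inj₂ (inj₂ refl) = owned-sameSide-antipodalʳ o<2r o′-owns o-owns

module Vertices (r : ℕ) where

  V : Set
  V = Fin (2 * r)

  pair side : V → ℕ
  pair v = toℕ v / 2
  side v = toℕ v % 2

  side<2 : ∀ v → side v < 2
  side<2 v = m%n<n (toℕ v) 2

  pair<r : ∀ v → pair v < r
  pair<r v = m<n*o⇒m/o<n (subst (toℕ v <_) (*-comm 2 r) (Finₚ.toℕ<n v))

  toℕ≡side+pair*2 : ∀ v → toℕ v ≡ side v + pair v * 2
  toℕ≡side+pair*2 v = m≡m%n+[m/n]*n (toℕ v) 2

  mate : V → V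
  mate v = Fin.fromℕ< mate<2r
    where
      mate<2r : 1 ∸ side v + pair v * 2 < 2 * r
      mate<2r = begin-strict
        1 ∸ side v + pair v * 2 ≤⟨ +-monoˡ-≤ (pair v * 2) (m∸n≤m 1 (side v)) ⟩
        1 + pair v * 2          <⟨ n<1+n _ ⟩
        suc (pair v) * 2        ≤⟨ *-monoˡ-≤ 2 (pair<r v) ⟩
        r * 2                   ≡⟨ *-comm r 2 ⟩
        2 * r                   ∎
        where open ≤-Reasoning

  toℕ-mate : ∀ v → toℕ (mate v) ≡ 1 ∸ side v + pair v * 2
  toℕ-mate v = Finₚ.toℕ-fromℕ< _

  mate≢ : ∀ v → mate v ≢ v
  mate≢ v mate≡v = 1∸n≢n (side v) (+-cancelʳ-≡ (pair v * 2) (1 ∸ side v) (side v)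
    (trans (sym (toℕ-mate v)) (trans (cong toℕ mate≡v) (toℕ≡side+pair*2 v))))

  pair-mate : ∀ v → pair (mate v) ≡ pair v
  pair-mate v = proj₂ (quotient-remainder-unique (side<2 (mate v)) (s≤s (m∸n≤m 1 (side v)))
    (trans (sym (toℕ≡side+pair*2 (mate v))) (toℕ-mate v)))

  samePair⇒≡⊎≡mate : ∀ {u v} → pair u ≡ pair v → u ≡ v ⊎ u ≡ mate v
  samePair⇒≡⊎≡mate {u} {v} pu≡pv with <2⇒≡⊎≡1∸ (side<2 u) (side<2 v)
  ... | inj₁ su≡sv  = inj₁ (Finₚ.toℕ-injective (begin
    toℕ u                    ≡⟨ toℕ≡side+pair*2 u ⟩
    side u + pair u * 2      ≡⟨ cong₂ (λ s q → s + q * 2) su≡sv pu≡pv ⟩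
    side v + pair v * 2      ≡⟨ toℕ≡side+pair*2 v ⟨
    toℕ v                    ∎))
    where open ≡-Reasoning
  ... | inj₂ su≡1∸sv = inj₂ (Finₚ.toℕ-injective (begin
    toℕ u                    ≡⟨ toℕ≡side+pair*2 u ⟩
    side u + pair u * 2      ≡⟨ cong₂ (λ s q → s + q * 2) su≡1∸sv pu≡pv ⟩
    1 ∸ side v + pair v * 2  ≡⟨ toℕ-mate v ⟨
    toℕ (mate v)             ∎))
    where open ≡-Reasoning

  OctAdj? : ∀ u v → Dec (OctAdj r u v)
  OctAdj? u v = ¬? (u Fin.≟ v) ×-dec ¬? (pair u ≟ pair v)

  ¬adjacent⇒≡⊎≡mate : ∀ {u v} → ¬ OctAdj r u v → v ≡ u ⊎ v ≡ mate u
  ¬adjacent⇒≡⊎≡mate {u} {v} ¬uv with u Fin.≟ v | pair v ≟ pair u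
  ... | yes u≡v | _          = inj₁ (sym u≡v)
  ... | no _    | yes pv≡pu  = samePair⇒≡⊎≡mate pv≡pu
  ... | no u≢v  | no pv≢pu   = contradiction (u≢v , pv≢pu ∘ sym) ¬uv

  ¬adjacent-mate : ∀ v → ¬ OctAdj r v (mate v)
  ¬adjacent-mate v (_ , pv≢pmv) = pv≢pmv (sym (pair-mate v))

  2r≤degree+2 : ∀ u → 2 * r ≤ ∑[ v < 2 * r ] iverson (OctAdj? u v) + 2
  2r≤degree+2 u = begin
    2 * r                                            ≡⟨ trans (∑-const (2 * r) 1) (*-identityʳ (2 * r)) ⟨
    ∑[ v < 2 * r ] 1                                 ≤⟨ ∑-mono-≤ (λ v → covered (OctAdj? u v) (v Fin.≟ u) (v Fin.≟ mate u)) ⟩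
    ∑[ v < 2 * r ] (adj v + (δ u v + δ (mate u) v))  ≡⟨ ∑-distrib-+ adj (λ v → δ u v + δ (mate u) v) ⟩
    degree + ∑[ v < 2 * r ] (δ u v + δ (mate u) v)   ≡⟨ cong (degree +_) (∑-distrib-+ (δ u) (δ (mate u))) ⟩
    degree + (sum (δ u) + sum (δ (mate u)))          ≡⟨ cong (degree +_) (cong₂ _+_ (∑-δ≡1 u) (∑-δ≡1 (mate u))) ⟩
    degree + 2                                       ∎
    where
      open ≤-Reasoning
      adj : V → ℕ
      adj v = iverson (OctAdj? u v)
      degree : ℕ
      degree = ∑[ v < 2 * r ] adj v
      covered : ∀ {v} (a : Dec (OctAdj r u v)) (b : Dec (v ≡ u)) (c : Dec (v ≡ mate u)) →
                1 ≤ iverson a + (iverson b + iverson c)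
      covered (yes _) _       _       = s≤s z≤n
      covered (no _)  (yes _) _       = s≤s z≤n
      covered (no _)  (no _)  (yes _) = s≤s z≤n
      covered (no ¬a) (no ¬b) (no ¬c) = ⊥-elim ([ ¬b , ¬c ] (¬adjacent⇒≡⊎≡mate ¬a))

module Embedding (r : ℕ) .{{_ : NonZero r}} where
  open Vertices r
  open Circle r

  position : V → ℕ
  position v = pair v + side v * r

  position<2r : ∀ v → position v < 2 * r
  position<2r v = +-mono-<-≤ (pair<r v) (*-monoˡ-≤ r (≤-pred (side<2 v)))

  position-injective : ∀ {u v} → position u ≡ position v → u ≡ v
  position-injective {u} {v} eq with quotient-remainder-unique (pair<r u) (pair<r v) eq
  ... | pu≡pv , su≡sv = Finₚ.toℕ-injective (begin
    toℕ u               ≡⟨ toℕ≡side+pair*2 u ⟩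
    side u + pair u * 2 ≡⟨ cong₂ (λ s q → s + q * 2) su≡sv pu≡pv ⟩
    side v + pair v * 2 ≡⟨ toℕ≡side+pair*2 v ⟨
    toℕ v               ∎)
    where open ≡-Reasoning

  antipodal⇒samePair : ∀ {u v} → position v ≡ position u + r → pair v ≡ pair u
  antipodal⇒samePair {u} {v} eq = proj₁ (quotient-remainder-unique {h = side v} {k = suc (side u)} (pair<r v) (pair<r u)
    (trans eq (trans (+-assoc (pair u) (side u * r) r) (cong (pair u +_) (+-comm (side u * r) r)))))

  adjacent⇒chord : ∀ {u v} → OctAdj r u v → Chord (position u) (position v)
  adjacent⇒chord {u} {v} (u≢v , pu≢pv) =
    u≢v ∘ position-injective , pu≢pv ∘ sym ∘ antipodal⇒samePair {u} {v} , pu≢pv ∘ antipodal⇒samePair {v} {u}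

  -- Opaque, so that the type checker never unfolds the div/mod arithmetic
  -- of positions.
  opaque
    pos : V → V
    pos v = Fin.fromℕ< (position<2r v)

    place≡position : ∀ v → toℕ (pos v) ≡ position v
    place≡position v = Finₚ.toℕ-fromℕ< (position<2r v)

  place : V → ℕ
  place v = toℕ (pos v)

  place<2r : ∀ v → place v < 2 * r
  place<2r v = Finₚ.toℕ<n (pos v)

  place-injective : ∀ {u v} → place u ≡ place v → u ≡ v
  place-injective {u} {v} eq = position-injective (trans (sym (place≡position u)) (trans eq (place≡position v)))

  pos-injective : ∀ {u v} → pos u ≡ pos v → u ≡ v
  pos-injective = place-injective ∘ cong toℕ

  adjacent⇒chord-place : ∀ {u v} → OctAdj r u v → Chord (place u) (place v)
  adjacent⇒chord-place {u} {v} uv = subst₂ Chord (sym (place≡position u)) (sym (place≡position v)) (adjacent⇒chord uv)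

  page : V → V → Fin r
  page u v = owner (place u) (place v) mod r

  page-sym : ∀ u v → OctAdj r u v → page u v ≡ page v u
  page-sym u v uv = cong (_mod r) (owner-sym (adjacent⇒chord-place uv))

  OnPage : Fin r → V → V → Set
  OnPage p u v = OctAdj r u v × page u v ≡ p

  owner%r≡page : ∀ {p u v} → OnPage p u v → owner (place u) (place v) % r ≡ toℕ p
  owner%r≡page (_ , refl) = sym (Finₚ.toℕ-fromℕ< _)

  Centre : Fin r → V → Set
  Centre p v = place v % r ≡ toℕ p

  centre-end : ∀ {p u v} → OnPage p u v → Centre p u ⊎ Centre p v
  centre-end {p} {u} {v} uv with owner-spec (adjacent⇒chord-place (proj₁ uv))
  ... | inj₁ (_ , owner≡Pu) = inj₁ (trans (cong (_% r) (sym owner≡Pu)) (owner%r≡page uv))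
  ... | inj₂ (_ , owner≡Pv) = inj₂ (trans (cong (_% r) (sym owner≡Pv)) (owner%r≡page uv))

  centres-nonadjacent : ∀ {p u v} → OnPage p u v → Centre p u → ¬ Centre p v
  centres-nonadjacent {u = u} {v} (uv , _) Cu Cv = chord⇒%≢ (place<2r u) (place<2r v) (adjacent⇒chord-place uv) (trans Cu (sym Cv))

  centre-owns : ∀ {p u c} → OnPage p u c → Centre p c → Owns (place c) (place u)
  centre-owns uc Cc with owner-spec (adjacent⇒chord-place (proj₁ uc))
  ... | inj₂ (c-owns , _)   = c-owns
  ... | inj₁ (_ , owner≡Pu) =
    contradiction Cc (centres-nonadjacent uc (trans (cong (_% r) (sym owner≡Pu)) (owner%r≡page uc)))

  one-centre : ∀ {p u c c′} → OnPage p u c → OnPage p u c′ → Centre p c → Centre p c′ → c ≡ c′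
  one-centre {u = u} {c} {c′} uc uc′ Cc Cc′ with ≡%⇒≡⊎antipodal (place<2r c) (place<2r c′) (trans Cc (sym Cc′))
  ... | inj₁ Pc≡Pc′ = place-injective Pc≡Pc′
  ... | inj₂ (inj₁ Pc′≡Pc+r) = contradiction (subst (λ o → Owns o (place u)) Pc′≡Pc+r (centre-owns uc′ Cc′))
                                  (owns-disjoint (subst (_< 2 * r) Pc′≡Pc+r (place<2r c′)) (centre-owns uc Cc))
  ... | inj₂ (inj₂ Pc≡Pc′+r) = contradiction (subst (λ o → Owns o (place u)) Pc≡Pc′+r (centre-owns uc Cc))
                                  (owns-disjoint (subst (_< 2 * r) Pc≡Pc′+r (place<2r c)) (centre-owns uc′ Cc′))

  OnPage-sym : ∀ {p u v} → OnPage p u v → OnPage p v u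
  OnPage-sym {u = u} {v} (uv , pe) = Graph.sym (octahedron r) uv , trans (sym (page-sym u v uv)) pe

  page-starForest : ∀ p → StarForest (OnPage p)
  page-starForest p = centres⇒starForest (Centre p) OnPage-sym centre-end centres-nonadjacent one-centre

  page-noncrossing : ∀ a b c d → OctAdj r a b → OctAdj r c d → page a b ≡ page c d → ¬ Cross pos a b c d
  page-noncrossing a b c d ab cd same-page crossing with Cross⇒endpoints≢ pos crossing
  ... | c≢a , c≢b , d≢a , d≢b = sameSide⇒¬Cross pos sides crossing
    where
      owner-residues : ∀ {x y} → owner (place a) (place b) ≡ x → owner (place c) (place d) ≡ y → x % r ≡ y % r
      owner-residues refl refl =
        trans (owner%r≡page (ab , refl)) (trans (cong toℕ same-page) (sym (owner%r≡page (cd , refl))))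

      place≢ : ∀ {x y} → y ≢ x → place x ≢ place y
      place≢ y≢x = y≢x ∘ sym ∘ place-injective

      sides : SameSide (place a) (place b) (place c) (place d)
      sides with owner-spec (adjacent⇒chord-place ab) | owner-spec (adjacent⇒chord-place cd)
      ... | inj₁ (a-owns , ≡a) | inj₁ (c-owns , ≡c) =
        owned-sameSide (place<2r a) (place<2r c) (place≢ c≢a) (owner-residues ≡a ≡c) a-owns c-owns
      ... | inj₁ (a-owns , ≡a) | inj₂ (d-owns , ≡d) = sameSide-swapʳ
        (owned-sameSide (place<2r a) (place<2r d) (place≢ d≢a) (owner-residues ≡a ≡d) a-owns d-owns)
      ... | inj₂ (b-owns , ≡b) | inj₁ (c-owns , ≡c) = sameSide-swapˡ
        (owned-sameSide (place<2r b) (place<2r c) (place≢ c≢b) (owner-residues ≡b ≡c) b-owns c-owns)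
      ... | inj₂ (b-owns , ≡b) | inj₂ (d-owns , ≡d) = sameSide-swapˡ (sameSide-swapʳ
        (owned-sameSide (place<2r b) (place<2r d) (place≢ d≢b) (owner-residues ≡b ≡d) b-owns d-owns))

  embedding : StarBookEmbedding (octahedron r) r
  embedding = record
    { pos      = pos
    ; pos-inj  = pos-injective
    ; page     = page
    ; page-sym = page-sym
    ; noCross  = page-noncrossing
    ; stars    = page-starForest
    }

r≤j-by-counting : ∀ {r j D} → 0 < j → 2 * r * (2 * r) ≤ D + 2 * r * 2 → D + j * 4 ≤ j * (2 * (2 * r)) → r ≤ j
r≤j-by-counting {r} {j} {D} 0<j vertex-count page-count with r ≤? j
... | yes r≤j = r≤j
... | no r≰j = contradiction (+-cancelˡ-≤ (r * j + r) j 0 (begin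
    r * j + r + j     ≡⟨ solve 2 (λ r j → r :* j :+ r :+ j := r :* (con 1 :+ j) :+ j) refl r j ⟩
    r * suc j + j     ≤⟨ +-monoˡ-≤ j (*-monoʳ-≤ r (≰⇒> r≰j)) ⟩
    r * r + j         ≤⟨ *-cancelˡ-≤ 4 four-fold ⟩
    r * j + r         ≡⟨ +-identityʳ _ ⟨
    r * j + r + 0     ∎)) (<⇒≱ 0<j)
  where
    open ≤-Reasoning
    four-fold : 4 * (r * r + j) ≤ 4 * (r * j + r)
    four-fold = begin
      4 * (r * r + j)                  ≡⟨ solve 2 (λ r j → con 4 :* (r :* r :+ j) := con 2 :* r :* (con 2 :* r) :+ j :* con 4) refl r j ⟩
      2 * r * (2 * r) + j * 4          ≤⟨ +-monoˡ-≤ (j * 4) vertex-count ⟩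
      D + 2 * r * 2 + j * 4            ≡⟨ solve 3 (λ D r j → D :+ con 2 :* r :* con 2 :+ j :* con 4 := D :+ j :* con 4 :+ con 2 :* r :* con 2) refl D r j ⟩
      D + j * 4 + 2 * r * 2            ≤⟨ +-monoˡ-≤ (2 * r * 2) page-count ⟩
      j * (2 * (2 * r)) + 2 * r * 2    ≡⟨ solve 2 (λ r j → j :* (con 2 :* (con 2 :* r)) :+ con 2 :* r :* con 2 := con 4 :* (r :* j :+ r)) refl r j ⟩
      4 * (r * j + r)                  ∎

module LowerBound (r : ℕ) .{{_ : NonZero r}} {j} (E : StarBookEmbedding (octahedron r) j) where
  open StarBookEmbedding E
  open Vertices r

  OnPage : Fin j → V → V → Set
  OnPage p u v = OctAdj r u v × page u v ≡ p

  OnPage? : ∀ p u v → Dec (OnPage p u v)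
  OnPage? p u v = OctAdj? u v ×-dec (page u v Fin.≟ p)

  vertex₀ : V
  vertex₀ = Fin.fromℕ< (<-≤-trans (>-nonZero⁻¹ r) (m≤m+n r (r + 0)))

  OnPage-sym : ∀ {p u v} → OnPage p u v → OnPage p v u
  OnPage-sym {u = u} {v} (uv , pe) = Graph.sym (octahedron r) uv , trans (sym (page-sym u v uv)) pe

  OnPage-irrefl : ∀ {p u} → ¬ OnPage p u u
  OnPage-irrefl (uu , _) = Graph.irrefl (octahedron r) uu

  page-degree-sum : ∀ p → ∑[ u < 2 * r ] ∑[ v < 2 * r ] iverson (OnPage? p u v) + 4 ≤ 2 * (2 * r)
  page-degree-sum p = degree-sum+4≤2m vertex₀ (λ u → mate u , mate≢ u , ¬adjacent-mate u ∘ proj₁)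
    where open StarForestOrientation (OnPage? p) OnPage-sym OnPage-irrefl (stars p)

  degree-sum≤∑pages : ∑[ u < 2 * r ] ∑[ v < 2 * r ] iverson (OctAdj? u v) ≤
                      ∑[ p < j ] ∑[ u < 2 * r ] ∑[ v < 2 * r ] iverson (OnPage? p u v)
  degree-sum≤∑pages = begin
    ∑[ u < 2 * r ] ∑[ v < 2 * r ] iverson (OctAdj? u v)
      ≤⟨ ∑-mono-≤ (λ u → ∑-mono-≤ (λ v → on-its-page u v (OctAdj? u v))) ⟩
    ∑[ u < 2 * r ] ∑[ v < 2 * r ] ∑[ p < j ] iverson (OnPage? p u v)
      ≡⟨ sum-cong-≗ (λ u → ∑-comm (λ v p → iverson (OnPage? p u v))) ⟩
    ∑[ u < 2 * r ] ∑[ p < j ] ∑[ v < 2 * r ] iverson (OnPage? p u v)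
      ≡⟨ ∑-comm (λ u p → ∑[ v < 2 * r ] iverson (OnPage? p u v)) ⟩
    ∑[ p < j ] ∑[ u < 2 * r ] ∑[ v < 2 * r ] iverson (OnPage? p u v) ∎
    where
      open ≤-Reasoning
      on-its-page : ∀ u v (a : Dec (OctAdj r u v)) → iverson a ≤ ∑[ p < j ] iverson (OnPage? p u v)
      on-its-page u v (no _)   = z≤n
      on-its-page u v (yes uv) = ≤-trans (≤-reflexive (sym (iverson-yes (OnPage? (page u v) u v) (uv , refl))))
                                         (term≤∑ (λ p → iverson (OnPage? p u v)) (page u v))

  r≤j : r ≤ j
  r≤j = r≤j-by-counting (≤-<-trans z≤n (Finₚ.toℕ<n (page vertex₀ vertex₀))) vertex-count page-count
    where
      open ≤-Reasoning
      n D : ℕ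
      n = 2 * r
      D = ∑[ u < n ] ∑[ v < n ] iverson (OctAdj? u v)
      Eₚ : Fin j → ℕ
      Eₚ p = ∑[ u < n ] ∑[ v < n ] iverson (OnPage? p u v)

      vertex-count : n * n ≤ D + n * 2
      vertex-count = begin
        n * n                                             ≡⟨ ∑-const n n ⟨
        ∑[ u < n ] n                                      ≤⟨ ∑-mono-≤ 2r≤degree+2 ⟩
        ∑[ u < n ] (∑[ v < n ] iverson (OctAdj? u v) + 2) ≡⟨ ∑-distrib-+ (λ u → ∑[ v < n ] iverson (OctAdj? u v)) (λ _ → 2) ⟩
        D + ∑[ u < n ] 2                                  ≡⟨ cong (D +_) (∑-const n 2) ⟩
        D + n * 2                                         ∎

      page-count : D + j * 4 ≤ j * (2 * n)
      page-count = begin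
        D + j * 4                      ≤⟨ +-monoˡ-≤ (j * 4) degree-sum≤∑pages ⟩
        ∑[ p < j ] Eₚ p + j * 4        ≡⟨ cong (∑[ p < j ] Eₚ p +_) (∑-const j 4) ⟨
        ∑[ p < j ] Eₚ p + ∑[ p < j ] 4 ≡⟨ ∑-distrib-+ Eₚ (λ _ → 4) ⟨
        ∑[ p < j ] (Eₚ p + 4)          ≤⟨ ∑-mono-≤ page-degree-sum ⟩
        ∑[ p < j ] (2 * n)             ≡⟨ ∑-const j (2 * n) ⟩
        j * (2 * n)                    ∎

-- The argument only needs r ≠ 0.
corollary1 : ∀ (r : ℕ) → 4 ≤ r → SabtIs (octahedron r) r
corollary1 r@(suc _) _ = Embedding.embedding r , λ j E → LowerBound.r≤j r E
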